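{- For every $i\ge1$, the subalgebra $\mathcal B^i$ of $\mathcal H$ generated by $\mathcal G^i\cup\{1\}$ is a Hopf algebra, i.e. $\Delta(\mathcal B^i)\subseteq\mathcal B^i\otimes\mathcal B^i$.
   Context: An ordered forest of degree $n\ge0$ is a planar rooted forest (left-to-right sequence of rooted trees, children of each vertex linearly ordered left to right) with $n$ vertices together with a bijection from its vertex set to $\{1,\dots,n\}$ (labels); edges point towards roots; $1$ is the empty forest, $\bullet_1$ the one-vertex tree, $|F|$ the degree. The product $FG$ is concatenation, labels of $F$ kept, labels of $G$ increased by $|F|$. A subset $\boldsymbol v$ of vertices of $F$ is an admissible cut if no two distinct elements are joined by a directed path; $Lea_{\boldsymbol v}(F)$ is the subforest of vertices whose path to the root meets $\boldsymbol v$, $Roo_{\boldsymbol v}(F)$ the subforest of the other vertices, both with inherited planar structure and labels standardized onto $\{1,\dots,k\}$ increasingly. $\mathcal H$ is the $\mathbb K$-vector space with basis the ordered forests, with this product and coproduct $\Delta(F)=\sum_{\boldsymbol v}Lea_{\boldsymbol v}(F)\otimes Roo_{\boldsymbol v}(F)$ over all admissible cuts; it is a graded Hopf algebra. For $n\ge1$ and $\underline\varepsilon=(\varepsilon_1,\dots,\varepsilon_n)\in\{+,-\}^n$ define sets $\mathcal G^{(\underline\varepsilon)}$ of ordered forests of degree $n$ recursively: $\mathcal G^{(\varepsilon_1)}=\{\bullet_1\}$; for $n\ge2$, let $F'$ range over $\mathcal G^{(\varepsilon_1,\dots,\varepsilon_{n-1})}$ with trees $T_1,\dots,T_m$ from left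 to right; all vertices of $F'$ keep their labels and a new vertex labelled $n$ is added. If $\varepsilon_n=-$: add a new root whose children are the roots of $T_1,\dots,T_m$ in order. If $\varepsilon_n=+$: either add the new vertex as a one-vertex tree at the right end, or, for some $1\le i\le m$, attach the new vertex as rightmost child of the root of $T_i$ and make the roots of $T_{i+1},\dots,T_m$ (in order) the children of the new vertex. (Note $\mathcal G^{(\underline\varepsilon)}$ does not depend on $\varepsilon_1$.) For $i\ge1$, $\mathcal G^i$ is the union of the sets $\mathcal G^{(\varepsilon_1,\dots,\varepsilon_n)}$ over all $n\ge1$ and all words with $\varepsilon_1=\dots=\varepsilon_{n-i}=+$ (no condition when $n\le i$). -}

module Defs where

open import Level using (Level; _⊔_; suc)
open import Data.Nat as ℕ using (ℕ; zero; _+_; _∸_; _<?_)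
import Data.Nat.Properties as ℕP
open import Data.List using (List; []; _∷_; _++_; [_]; map; concatMap; length; take; _∷ʳ_; foldr; sum)
open import Data.List.Relation.Unary.All using (All)
open import Data.Product using (Σ; _×_; _,_; ∃)
open import Data.Bool using (Bool; true; false; if_then_else_; _∧_)
open import Relation.Binary.PropositionalEquality using (_≡_; refl; cong; cong₂)
open import Relation.Nullary using (Dec; yes; no; ¬_; does)
open import Relation.Nullary.Decidable using (map′)
open import Algebra.Bundles using (CommutativeRing)

record Field (c ℓ : Level) : Set (Level.suc (c ⊔ ℓ)) where
  field
    commutativeRing : CommutativeRing c ℓ
  open CommutativeRing commutativeRing public
  field
    0≉1     : ¬ (0# ≈ 1#)
    inverse : ∀ x → ¬ (x ≈ 0#) → Σ Carrier λ y → x * y ≈ 1#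

-- An ordered
-- forest of degree n is such a forest whose labels are a bijection onto
-- {1,…,n}; all forests built below (generators, products, Lea/Roo) have
-- this property, so we work with the raw syntax and syntactic equality.

data Tree : Set where
  node : ℕ → List Tree → Tree

Forest : Set
Forest = List Tree

leaf : ℕ → Tree
leaf n = node n []

mutual
  sizeT : Tree → ℕ
  sizeT (node _ ts) = ℕ.suc (sizeF ts)

  sizeF : Forest → ℕ
  sizeF [] = 0
  sizeF (t ∷ ts) = sizeT t + sizeF ts

mutual
  labelsT : Tree → List ℕ
  labelsT (node a ts) = a ∷ labelsF ts

  labelsF : Forest → List ℕ
  labelsF [] = []
  labelsF (t ∷ ts) = labelsT t ++ labelsF ts

mutual
  relabelT : (ℕ → ℕ) → Tree → Tree
  relabelT f (node a ts) = node (f a) (relabelF f ts)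

  relabelF : (ℕ → ℕ) → Forest → Forest
  relabelF f [] = []
  relabelF f (t ∷ ts) = relabelT f t ∷ relabelF f ts

_·_ : Forest → Forest → Forest
F · G = F ++ relabelF (sizeF F +_) G

-- Standardization: each label x is replaced by its rank 1 + #{labels < x}
-- (labels are pairwise distinct), i.e. labels are mapped increasingly
-- onto {1,…,k}.
countLess : ℕ → List ℕ → ℕ
countLess x [] = 0
countLess x (y ∷ ys) = if does (y <? x) then ℕ.suc (countLess x ys) else countLess x ys

std : Forest → Forest
std F = relabelF (λ x → ℕ.suc (countLess x (labelsF F))) F

-- An admissible cut v (a set of vertices, no two on a
-- common directed path) is enumerated recursively: at each vertex, either
-- the vertex belongs to v (its whole subtree goes to Lea) or it does not,
-- and the cut is chosen recursively in its children.  Each admissible cut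
-- (including the empty one) is listed exactly once.  For each cut we record
-- the pair (Lea_v(F), Roo_v(F)) before standardization of labels.

mutual
  cutsT : Tree → List (Forest × Forest)
  cutsT (node a ts) =
    ([ node a ts ] , []) ∷ map (λ { (l , r) → (l , [ node a r ]) }) (cutsF ts)

  cutsF : Forest → List (Forest × Forest)
  cutsF [] = [ ([] , []) ]
  cutsF (t ∷ ts) =
    concatMap (λ { (l₁ , r₁) → map (λ { (l₂ , r₂) → (l₁ ++ l₂ , r₁ ++ r₂) }) (cutsF ts) })
              (cutsT t)

-- Δ(F) = Σ_v Lea_v(F) ⊗ Roo_v(F), as the list of its terms.
Δterms : Forest → List (Forest × Forest)
Δterms F = map (λ { (l , r) → (std l , std r) }) (cutsF F)

node-inj₁ : ∀ {a b ts us} → node a ts ≡ node b us → a ≡ b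
node-inj₁ refl = refl

node-inj₂ : ∀ {a b ts us} → node a ts ≡ node b us → ts ≡ us
node-inj₂ refl = refl

∷-inj₁ : ∀ {t u : Tree} {ts us} → t ∷ ts ≡ u ∷ us → t ≡ u
∷-inj₁ refl = refl

∷-inj₂ : ∀ {t u : Tree} {ts us} → t ∷ ts ≡ u ∷ us → ts ≡ us
∷-inj₂ refl = refl

mutual
  _≟T_ : (t u : Tree) → Dec (t ≡ u)
  node a ts ≟T node b us with a ℕ.≟ b | ts ≟F us
  ... | yes refl | yes refl = yes refl
  ... | no a≢b  | _        = no λ e → a≢b (node-inj₁ e)
  ... | yes _   | no ts≢us = no λ e → ts≢us (node-inj₂ e)

  _≟F_ : (F G : Forest) → Dec (F ≡ G)
  [] ≟F [] = yes refl
  [] ≟F (_ ∷ _) = no λ ()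
  (_ ∷ _) ≟F [] = no λ ()
  (t ∷ ts) ≟F (u ∷ us) with t ≟T u | ts ≟F us
  ... | yes refl | yes refl = yes refl
  ... | no t≢u  | _        = no λ e → t≢u (∷-inj₁ e)
  ... | yes _   | no ts≢us = no λ e → ts≢us (∷-inj₂ e)

data Sign : Set where
  plus minus : Sign

data PlusStep (n : ℕ) : Forest → Forest → Set where
  atRight : ∀ F → PlusStep n F (F ++ [ leaf n ])
  attach  : ∀ (pre : Forest) (a : ℕ) (cs post : Forest) →
            PlusStep n (pre ++ node a cs ∷ post)
                       (pre ++ [ node a (cs ++ [ node n post ]) ])

data Gen : List Sign → Forest → Set where
  base  : ∀ e → Gen [ e ] [ leaf 1 ]
  minus : ∀ {ws F} → Gen ws F →
          Gen (ws ∷ʳ minus) [ node (ℕ.suc (length ws)) F ]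
  plus  : ∀ {ws F F′} → Gen ws F → PlusStep (ℕ.suc (length ws)) F F′ →
          Gen (ws ∷ʳ plus) F′

InG : ℕ → Forest → Set
InG i F = Σ (List Sign) λ ws → Gen ws F × All (_≡ plus) (take (length ws ∸ i) ws)

-- Monomials of B^i: finite products of elements of G^i (empty product = 1).
-- B^i is the K-span of these forests.
data InB (i : ℕ) : Forest → Set where
  one : InB i []
  mul : ∀ {G F} → InG i G → InB i F → InB i (G · F)

-- Coefficient of the basis element A ⊗ B in Δ(F), as an element of K.

module _ {c ℓ} (K : Field c ℓ) where
  open Field K using (Carrier; 0#; 1#) renaming (_+_ to _+K_)

  coeffΔ : Forest → Forest → Forest → Carrier
  coeffΔ F A B =
    foldr (λ { (l , r) acc →
                 if does (l ≟F A) ∧ does (r ≟F B) then 1# +K acc else acc })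
          0# (Δterms F)

-- Membership in G^b can be read off the shape of a forest, with its labels left unstandardised.  Forests built by
-- plus steps alone are the plus forests: trees whose label sets increase from left to right, each root carrying the
-- smallest label of its tree and each child of a root the largest label of its own subtree, below which hangs again a
-- plus forest.  A forest of G^b (all signs + except possibly the last b) is such a forest whose first tree may instead
-- have a minus root: the largest label of a forest of G^(b-1-|N|), followed by plus children N with |N| < b.  These
-- shapes survive admissible cuts: Lea_v(F) is an increasing product of forests of G^i shape (a detached child of a plus
-- root becomes a minus root, which needs i ≥ 1), and Roo_v(F) keeps its shape and budget.  Standardising an increasing
-- product gives the product of the standardised factors, so both sides of every term of Δ(F) are monomials of B^i.

module Submission where

open import Defs
open import Level using (Level)
open import Data.Nat using (ℕ; _≥_; zero; suc; _+_; _∸_; _<_; _≤_; z≤n; s≤s; s≤s⁻¹; _<?_)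
open import Data.Nat.Properties
open import Data.Product using (_×_; _,_; proj₁; proj₂)
open import Relation.Nullary using (¬_; yes; no; does)
open import Data.Bool using (true; false; _∧_; if_then_else_)
open import Data.Empty using (⊥-elim)
open import Data.Sum using (_⊎_; inj₁; inj₂; [_,_]′)
open import Data.List using (List; []; _∷_; _++_; [_]; map; length; take; _∷ʳ_; foldr; filter)
open import Data.List.Properties using (++-assoc; ++-identityʳ; map-++; length-++; take-all; filter-++; filter-all; filter-none)
open import Data.List.Reverse using (reverseView; []; _∶_∶ʳ_)
open import Data.List.Membership.Propositional using (_∈_; find)
open import Data.List.Membership.Propositional.Properties
  using (∈-++⁺ˡ; ∈-++⁺ʳ; ∈-++⁻; ∈-map⁺; ∈-map⁻; ∈-concatMap⁺; ∈-concatMap⁻)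
open import Data.List.Relation.Unary.Any as Any using (here; there)
open import Data.List.Relation.Unary.All as All using (All; []; _∷_)
import Data.List.Relation.Unary.All.Properties as All
open import Data.List.Relation.Binary.Subset.Propositional using (_⊆_)
open import Data.List.Relation.Binary.Subset.Propositional.Properties using (⊆-reflexive)
open import Data.List.Relation.Binary.Permutation.Propositional
  using (_↭_; prep; ↭-sym; ↭-trans; ↭-reflexive; module PermutationReasoning)
open import Data.List.Relation.Binary.Permutation.Propositional.Properties
  using (∈-resp-↭; ↭-length; ++⁺ˡ; ∷↭∷ʳ; filter-↭)
open import Relation.Binary.Core using (_Preserves_⟶_)
open import Relation.Binary.PropositionalEquality
  using (_≡_; refl; sym; trans; cong; cong₂; subst; subst₂; module ≡-Reasoning)
open import Function using (_∘_; id)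

private
  variable
    x y n a : ℕ
    xs xs′ ys ys′ : List ℕ
    t : Tree
    F G ts cs l r : Forest

infix 4 _≪_

_≪_ : List ℕ → List ℕ → Set
xs ≪ ys = ∀ {x y} → x ∈ xs → y ∈ ys → x < y

≪-⊆ : xs′ ⊆ xs → ys′ ⊆ ys → xs ≪ ys → xs′ ≪ ys′
≪-⊆ xs′⊆xs ys′⊆ys xs≪ys p q = xs≪ys (xs′⊆xs p) (ys′⊆ys q)

≪-[]ˡ : [] ≪ ys
≪-[]ˡ ()

≪-[]ʳ : xs ≪ []
≪-[]ʳ _ ()

≪-++ˡ : ∀ {zs} → xs ≪ zs → ys ≪ zs → xs ++ ys ≪ zs
≪-++ˡ {xs = xs} xs≪zs ys≪zs p q = [ (λ p′ → xs≪zs p′ q) , (λ p′ → ys≪zs p′ q) ]′ (∈-++⁻ xs p)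

≪-++ʳ : ∀ {zs} → xs ≪ ys → xs ≪ zs → xs ≪ ys ++ zs
≪-++ʳ {ys = ys} xs≪ys xs≪zs p q = [ xs≪ys p , xs≪zs p ]′ (∈-++⁻ ys q)

≪-∷ˡ : [ x ] ≪ ys → xs ≪ ys → x ∷ xs ≪ ys
≪-∷ˡ x≪ys xs≪ys (here refl) = x≪ys (here refl)
≪-∷ˡ x≪ys xs≪ys (there p)   = xs≪ys p

≪-∷ʳ : xs ≪ [ y ] → xs ≪ ys → xs ≪ y ∷ ys
≪-∷ʳ xs≪y xs≪ys p (here refl) = xs≪y p (here refl)
≪-∷ʳ xs≪y xs≪ys p (there q)   = xs≪ys p q

∷-⊆ : xs′ ⊆ xs → x ∷ xs′ ⊆ x ∷ xs
∷-⊆ xs′⊆xs (here e)  = here e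
∷-⊆ xs′⊆xs (there p) = there (xs′⊆xs p)

length-∷ʳ : ∀ {A : Set} (xs : List A) z → length (xs ∷ʳ z) ≡ suc (length xs)
length-∷ʳ xs z = trans (length-++ xs) (+-comm (length xs) 1)

take-∷ʳ : ∀ {A : Set} k (xs : List A) z → k ≤ length xs → take k (xs ∷ʳ z) ≡ take k xs
take-∷ʳ zero    xs       z _         = refl
take-∷ʳ (suc k) (y ∷ xs) z (s≤s k≤n) = cong (y ∷_) (take-∷ʳ k xs z k≤n)

labelsF-++ : ∀ F G → labelsF (F ++ G) ≡ labelsF F ++ labelsF G
labelsF-++ []      G = refl
labelsF-++ (t ∷ F) G = trans (cong (labelsT t ++_) (labelsF-++ F G)) (sym (++-assoc (labelsT t) (labelsF F) (labelsF G)))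

labelsF-[] : ∀ t → labelsF [ t ] ≡ labelsT t
labelsF-[] t = ++-identityʳ (labelsT t)

sizeF-++ : ∀ F G → sizeF (F ++ G) ≡ sizeF F + sizeF G
sizeF-++ []      G = refl
sizeF-++ (t ∷ F) G = trans (cong (sizeT t +_) (sizeF-++ F G)) (sym (+-assoc (sizeT t) (sizeF F) (sizeF G)))

sizeF-[] : ∀ t → sizeF [ t ] ≡ sizeT t
sizeF-[] t = +-identityʳ (sizeT t)

sizeF-∷ʳ : ∀ F t → sizeF (F ++ [ t ]) ≡ sizeF F + sizeT t
sizeF-∷ʳ F t = trans (sizeF-++ F [ t ]) (cong (sizeF F +_) (sizeF-[] t))

labels-++ˡ : ∀ F G → labelsF F ⊆ labelsF (F ++ G)
labels-++ˡ F G p rewrite labelsF-++ F G = ∈-++⁺ˡ p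

labels-++ʳ : ∀ F G → labelsF G ⊆ labelsF (F ++ G)
labels-++ʳ F G p rewrite labelsF-++ F G = ∈-++⁺ʳ (labelsF F) p

∈-labels-++⁻ : ∀ F G → x ∈ labelsF (F ++ G) → x ∈ labelsF F ⊎ x ∈ labelsF G
∈-labels-++⁻ F G p rewrite labelsF-++ F G = ∈-++⁻ (labelsF F) p

labels-[]⁺ : ∀ t → labelsT t ⊆ labelsF [ t ]
labels-[]⁺ t = ⊆-reflexive (sym (labelsF-[] t))

labels-[]⁻ : ∀ t → labelsF [ t ] ⊆ labelsT t
labels-[]⁻ t = ⊆-reflexive (labelsF-[] t)

mutual
  length-labelsT : ∀ t → length (labelsT t) ≡ sizeT t
  length-labelsT (node a ts) = cong suc (length-labelsF ts)

  length-labelsF : ∀ F → length (labelsF F) ≡ sizeF F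
  length-labelsF []      = refl
  length-labelsF (t ∷ F) = trans (length-++ (labelsT t)) (cong₂ _+_ (length-labelsT t) (length-labelsF F))

mutual
  labels-relabelT : ∀ f t → labelsT (relabelT f t) ≡ map f (labelsT t)
  labels-relabelT f (node a ts) = cong (f a ∷_) (labels-relabelF f ts)

  labels-relabelF : ∀ f F → labelsF (relabelF f F) ≡ map f (labelsF F)
  labels-relabelF f []      = refl
  labels-relabelF f (t ∷ F) =
    trans (cong₂ _++_ (labels-relabelT f t) (labels-relabelF f F)) (sym (map-++ f (labelsT t) (labelsF F)))

mutual
  size-relabelT : ∀ f t → sizeT (relabelT f t) ≡ sizeT t
  size-relabelT f (node a ts) = cong suc (size-relabelF f ts)

  size-relabelF : ∀ f F → sizeF (relabelF f F) ≡ sizeF F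
  size-relabelF f []      = refl
  size-relabelF f (t ∷ F) = cong₂ _+_ (size-relabelT f t) (size-relabelF f F)

relabelF-++ : ∀ f F G → relabelF f (F ++ G) ≡ relabelF f F ++ relabelF f G
relabelF-++ f []      G = refl
relabelF-++ f (t ∷ F) G = cong (relabelT f t ∷_) (relabelF-++ f F G)

mutual
  relabelT-cong : ∀ {f g} t → (∀ {x} → x ∈ labelsT t → f x ≡ g x) → relabelT f t ≡ relabelT g t
  relabelT-cong (node a ts) f≗g = cong₂ node (f≗g (here refl)) (relabelF-cong ts (f≗g ∘ there))

  relabelF-cong : ∀ {f g} F → (∀ {x} → x ∈ labelsF F → f x ≡ g x) → relabelF f F ≡ relabelF g F
  relabelF-cong []      f≗g = refl
  relabelF-cong (t ∷ F) f≗g =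
    cong₂ _∷_ (relabelT-cong t (f≗g ∘ ∈-++⁺ˡ)) (relabelF-cong F (f≗g ∘ ∈-++⁺ʳ (labelsT t)))

mutual
  relabelT-∘ : ∀ f g t → relabelT f (relabelT g t) ≡ relabelT (f ∘ g) t
  relabelT-∘ f g (node a ts) = cong (node (f (g a))) (relabelF-∘ f g ts)

  relabelF-∘ : ∀ f g F → relabelF f (relabelF g F) ≡ relabelF (f ∘ g) F
  relabelF-∘ f g []      = refl
  relabelF-∘ f g (t ∷ F) = cong₂ _∷_ (relabelT-∘ f g t) (relabelF-∘ f g F)

≪-labels-++ʳ : ∀ F G → xs ≪ labelsF F → xs ≪ labelsF G → xs ≪ labelsF (F ++ G)
≪-labels-++ʳ F G xs≪F xs≪G = ≪-⊆ id (⊆-reflexive (labelsF-++ F G)) (≪-++ʳ xs≪F xs≪G)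

≪-labels-++ˡ : ∀ F G → labelsF F ≪ ys → labelsF G ≪ ys → labelsF (F ++ G) ≪ ys
≪-labels-++ˡ F G F≪ys G≪ys = ≪-⊆ (⊆-reflexive (labelsF-++ F G)) id (≪-++ˡ F≪ys G≪ys)

data TreeCut (a : ℕ) (ts : Forest) : Forest → Forest → Set where
  whole : TreeCut a ts [ node a ts ] []
  below : (l , r) ∈ cutsF ts → TreeCut a ts l [ node a r ]

cutsT⁻ : (l , r) ∈ cutsT (node a ts) → TreeCut a ts l r
cutsT⁻ (here refl) = whole
cutsT⁻ (there p) with ∈-map⁻ _ p
... | _ , q , refl = below q

data ConsCut (t : Tree) (ts : Forest) : Forest → Forest → Set where
  cons-cut : ∀ {l₁ r₁ l₂ r₂} → (l₁ , r₁) ∈ cutsT t → (l₂ , r₂) ∈ cutsF ts →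
             ConsCut t ts (l₁ ++ l₂) (r₁ ++ r₂)

cutsF-∷⁻ : ∀ t ts → (l , r) ∈ cutsF (t ∷ ts) → ConsCut t ts l r
cutsF-∷⁻ t ts p with find (∈-concatMap⁻ _ {xs = cutsT t} p)
... | _ , m₁ , q with ∈-map⁻ _ q
... | _ , m₂ , refl = cons-cut m₁ m₂

cutsF-∷⁺ : ∀ {l₁ r₁ l₂ r₂} → (l₁ , r₁) ∈ cutsT t → (l₂ , r₂) ∈ cutsF ts →
           (l₁ ++ l₂ , r₁ ++ r₂) ∈ cutsF (t ∷ ts)
cutsF-∷⁺ {t = t} m₁ m₂ = ∈-concatMap⁺ _ {xs = cutsT t} (Any.map (λ { refl → ∈-map⁺ _ m₂ }) m₁)

cutsF-[]⁻ : (l , r) ∈ cutsF [] → l ≡ [] × r ≡ []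
cutsF-[]⁻ (here refl) = refl , refl

data AppCut (F G : Forest) : Forest → Forest → Set where
  app-cut : ∀ {l₁ r₁ l₂ r₂} → (l₁ , r₁) ∈ cutsF F → (l₂ , r₂) ∈ cutsF G →
            AppCut F G (l₁ ++ l₂) (r₁ ++ r₂)

cutsF-++⁻ : ∀ F G → (l , r) ∈ cutsF (F ++ G) → AppCut F G l r
cutsF-++⁻ []      G p = app-cut (here refl) p
cutsF-++⁻ (t ∷ F) G p with cutsF-∷⁻ t (F ++ G) p
... | cons-cut {l₁} {r₁} m₁ m₂ with cutsF-++⁻ F G m₂
...   | app-cut {l₂} {r₂} {l₃} {r₃} n₁ n₂ =
  subst₂ (AppCut (t ∷ F) G) (++-assoc l₁ l₂ l₃) (++-assoc r₁ r₂ r₃) (app-cut (cutsF-∷⁺ {ts = F} m₁ n₁) n₂)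

record CutBound (l r : Forest) (labels : List ℕ) (size : ℕ) : Set where
  field
    lea⊆     : labelsF l ⊆ labels
    roo⊆     : labelsF r ⊆ labels
    roo-size : sizeF r ≤ size

open CutBound

mutual
  cutsT-bound : ∀ t → (l , r) ∈ cutsT t → CutBound l r (labelsT t) (sizeT t)
  cutsT-bound (node a ts) p with cutsT⁻ p
  ... | whole = record { lea⊆ = labels-[]⁻ (node a ts) ; roo⊆ = λ () ; roo-size = z≤n }
  ... | below {r = r} q = record
    { lea⊆     = there ∘ lea⊆ b
    ; roo⊆     = ∷-⊆ (roo⊆ b) ∘ labels-[]⁻ (node a r)
    ; roo-size = subst (_≤ suc (sizeF ts)) (sym (sizeF-[] (node a r))) (s≤s (roo-size b))
    }
    where b = cutsF-bound ts q

  cutsF-bound : ∀ F → (l , r) ∈ cutsF F → CutBound l r (labelsF F) (sizeF F)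
  cutsF-bound [] p with cutsF-[]⁻ p
  ... | refl , refl = record { lea⊆ = λ () ; roo⊆ = λ () ; roo-size = z≤n }
  cutsF-bound (t ∷ F) p with cutsF-∷⁻ t F p
  ... | cons-cut {l₁} {r₁} {l₂} {r₂} m₁ m₂ = record
    { lea⊆     = [ ∈-++⁺ˡ ∘ lea⊆ b₁ , ∈-++⁺ʳ (labelsT t) ∘ lea⊆ b₂ ]′ ∘ ∈-labels-++⁻ l₁ l₂
    ; roo⊆     = [ ∈-++⁺ˡ ∘ roo⊆ b₁ , ∈-++⁺ʳ (labelsT t) ∘ roo⊆ b₂ ]′ ∘ ∈-labels-++⁻ r₁ r₂
    ; roo-size = subst (_≤ sizeT t + sizeF F) (sym (sizeF-++ r₁ r₂)) (+-mono-≤ (roo-size b₁) (roo-size b₂))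
    }
    where
    b₁ = cutsT-bound t m₁
    b₂ = cutsF-bound F m₂

plusStep-labels : PlusStep n F G → labelsF G ↭ labelsF F ++ [ n ]
plusStep-labels {n} (atRight F) = ↭-reflexive (labelsF-++ F [ leaf n ])
plusStep-labels {n} (attach pre a cs post) = begin
  labelsF (pre ++ [ node a (cs ++ [ node n post ]) ])
    ≡⟨ labelsF-++ pre _ ⟩
  labelsF pre ++ labelsF [ node a (cs ++ [ node n post ]) ]
    ≡⟨ cong (labelsF pre ++_) (trans (labelsF-[] (node a (cs ++ [ node n post ])))
                                  (cong (a ∷_) (trans (labelsF-++ cs [ node n post ]) (cong (labelsF cs ++_) (labelsF-[] (node n post)))))) ⟩
  labelsF pre ++ a ∷ labelsF cs ++ n ∷ labelsF post
    ↭⟨ ++⁺ˡ (labelsF pre) (prep a (++⁺ˡ (labelsF cs) (∷↭∷ʳ n (labelsF post)))) ⟩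
  labelsF pre ++ a ∷ labelsF cs ++ labelsF post ++ [ n ]
    ≡⟨ cong (labelsF pre ++_) (cong (a ∷_) (sym (++-assoc (labelsF cs) (labelsF post) [ n ]))) ⟩
  labelsF pre ++ (a ∷ labelsF cs ++ labelsF post) ++ [ n ]
    ≡⟨ sym (++-assoc (labelsF pre) _ [ n ]) ⟩
  (labelsF pre ++ a ∷ labelsF cs ++ labelsF post) ++ [ n ]
    ≡⟨ cong (_++ [ n ]) (sym (labelsF-++ pre (node a cs ∷ post))) ⟩
  labelsF (pre ++ node a cs ∷ post) ++ [ n ] ∎
  where open PermutationReasoning

plusStep-⊆ : PlusStep n F G → labelsF F ⊆ labelsF G
plusStep-⊆ step = ∈-resp-↭ (↭-sym (plusStep-labels step)) ∘ ∈-++⁺ˡ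

plusStep-∈⁻ : PlusStep n F G → x ∈ labelsF G → x ∈ labelsF F ⊎ x ≡ n
plusStep-∈⁻ {F = F} step p with ∈-++⁻ (labelsF F) (∈-resp-↭ (plusStep-labels step) p)
... | inj₁ q          = inj₁ q
... | inj₂ (here x≡n) = inj₂ x≡n

plusStep-size : PlusStep n F G → sizeF G ≡ suc (sizeF F)
plusStep-size {F = F} {G = G} step = begin
  sizeF G                         ≡⟨ sym (length-labelsF G) ⟩
  length (labelsF G)              ≡⟨ ↭-length (plusStep-labels step) ⟩
  length (labelsF F ++ _)         ≡⟨ length-∷ʳ (labelsF F) _ ⟩
  suc (length (labelsF F))        ≡⟨ cong suc (length-labelsF F) ⟩
  suc (sizeF F)                   ∎
  where open ≡-Reasoning

≪-plusStep : PlusStep n F G → xs ≪ labelsF F → xs ≪ [ n ] → xs ≪ labelsF G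
≪-plusStep step xs≪F xs≪n p q with plusStep-∈⁻ step q
... | inj₁ q′   = xs≪F p q′
... | inj₂ refl = xs≪n p (here refl)

relabel-plusStep : ∀ f → PlusStep n F G → PlusStep (f n) (relabelF f F) (relabelF f G)
relabel-plusStep {n} f (atRight F) =
  subst (PlusStep (f n) (relabelF f F)) (sym (relabelF-++ f F [ leaf n ])) (atRight (relabelF f F))
relabel-plusStep {n} f (attach pre a cs post) =
  subst₂ (PlusStep (f n)) (sym (relabelF-++ f pre (node a cs ∷ post)))
    (sym (trans (relabelF-++ f pre _) (cong (λ cs′ → relabelF f pre ++ [ node (f a) cs′ ]) (relabelF-++ f cs [ node n post ]))))
    (attach (relabelF f pre) (f a) (relabelF f cs) (relabelF f post))

-- The shape of the forests of G^b

mutual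
  data PlusTree : Tree → Set where
    root : PlusChildren cs → [ a ] ≪ labelsF cs → PlusTree (node a cs)

  data PlusChildren : Forest → Set where
    []    : PlusChildren []
    child : ∀ {P} → PlusForest P → labelsF P ≪ [ n ] → n ∷ labelsF P ≪ labelsF ts → PlusChildren ts →
            PlusChildren (node n P ∷ ts)

  data PlusForest : Forest → Set where
    []   : PlusForest []
    tree : PlusTree t → labelsT t ≪ labelsF ts → PlusForest ts → PlusForest (t ∷ ts)

-- GForest b F: F is, up to standardisation, in G^(ε) with all signs of ε equal to + except possibly the last b.
-- The first tree t was completed |ts| plus steps before the end, whence the budget b ∸ |ts|; a minus root is the
-- vertex of a minus step over F₀, followed by the |N| plus steps that attached its children N.
mutual
  data GTree (b : ℕ) : Tree → Set where
    plus-root  : PlusTree t → GTree b t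
    minus-root : ∀ {F₀ N} → cs ≡ F₀ ++ N → GForest (b ∸ suc (sizeF N)) F₀ → sizeF N < b →
                 labelsF F₀ ≪ [ a ] → a ∷ labelsF F₀ ≪ labelsF N → PlusChildren N → GTree b (node a cs)

  data GForest (b : ℕ) : Forest → Set where
    gforest : GTree (b ∸ sizeF ts) t → labelsT t ≪ labelsF ts → PlusForest ts → GForest b (t ∷ ts)

data Monomial (i : ℕ) : Forest → Set where
  []     : Monomial i []
  factor : GForest i F → labelsF F ≪ labelsF G → Monomial i G → Monomial i (F ++ G)

data AtMostOne (P : Tree → Set) : Forest → Set where
  none : AtMostOne P []
  just : P t → AtMostOne P [ t ]

data EmptyOr (P : Forest → Set) : Forest → Set where
  empty    : EmptyOr P []
  nonempty : P F → EmptyOr P F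

mutual
  GTree-mono : ∀ {b c} → b ≤ c → GTree b t → GTree c t
  GTree-mono b≤c (plus-root p) = plus-root p
  GTree-mono b≤c (minus-root {N = N} eq g N<b F₀≪a aF₀≪N ch) =
    minus-root eq (GForest-mono (∸-monoˡ-≤ (suc (sizeF N)) b≤c) g) (<-≤-trans N<b b≤c) F₀≪a aF₀≪N ch

  GForest-mono : ∀ {b c} → b ≤ c → GForest b F → GForest c F
  GForest-mono b≤c (gforest {ts = ts} g t≪ts pf) = gforest (GTree-mono (∸-monoˡ-≤ (sizeF ts) b≤c) g) t≪ts pf

GTree⇒GForest : ∀ {b} → GTree b t → GForest b [ t ]
GTree⇒GForest g = gforest g ≪-[]ʳ []

PlusForest⇒GForest : ∀ {b} → PlusForest F → EmptyOr (GForest b) F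
PlusForest⇒GForest []              = empty
PlusForest⇒GForest (tree p t≪ts pf) = nonempty (gforest (plus-root p) t≪ts pf)

module _ {i : ℕ} where

  GForest⇒Monomial : GForest i F → Monomial i F
  GForest⇒Monomial {F = F} g = subst (Monomial i) (++-identityʳ F) (factor g ≪-[]ʳ [])

  Monomial-++ : Monomial i F → Monomial i G → labelsF F ≪ labelsF G → Monomial i (F ++ G)
  Monomial-++ []                               mG F≪G = mG
  Monomial-++ {G = G} (factor {F = X} {G = Y} gX X≪Y mY) mG F≪G =
    subst (Monomial i) (sym (++-assoc X Y G))
          (factor gX (≪-labels-++ʳ Y G X≪Y (≪-⊆ (labels-++ˡ X Y) id F≪G))
                     (Monomial-++ mY mG (≪-⊆ (labels-++ʳ X Y) id F≪G)))

-- Closure under cuts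

module CutClosure {i : ℕ} (1≤i : 1 ≤ i) where

  child⇒GForest : ∀ {P} → PlusForest P → labelsF P ≪ [ n ] → GForest i [ node n P ]
  child⇒GForest []                  _   = GTree⇒GForest (plus-root (root [] ≪-[]ʳ))
  child⇒GForest {P = P} (tree p t≪ts pf) P≪n =
    GTree⇒GForest (minus-root (sym (++-identityʳ P)) (gforest (plus-root p) t≪ts pf) 1≤i P≪n ≪-[]ʳ [])

  mutual
    plusTree-cut : PlusTree t → (l , r) ∈ cutsT t → Monomial i l × AtMostOne PlusTree r
    plusTree-cut (root {cs = cs} ch a≪cs) p with cutsT⁻ p
    ... | whole   = GForest⇒Monomial (GTree⇒GForest (plus-root (root ch a≪cs))) , none
    ... | below q = let ml , ch′ = plusChildren-cut ch q in
                    ml , just (root ch′ (≪-⊆ id (roo⊆ (cutsF-bound cs q)) a≪cs))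

    plusChildren-cut : PlusChildren cs → (l , r) ∈ cutsF cs → Monomial i l × PlusChildren r
    plusChildren-cut [] p with cutsF-[]⁻ p
    ... | refl , refl = [] , []
    plusChildren-cut (child {n = n} {ts = ts} {P = P} pf P≪n nP≪ts ch) p with cutsF-∷⁻ (node n P) ts p
    ... | cons-cut m₁ m₂ with plusChildren-cut ch m₂ | cutsT⁻ m₁
    ...   | ml₂ , ch₂ | whole =
            Monomial-++ (GForest⇒Monomial (child⇒GForest pf P≪n)) ml₂
                        (≪-⊆ (labels-[]⁻ (node n P)) (lea⊆ (cutsF-bound ts m₂)) nP≪ts) ,
            ch₂
    ...   | ml₂ , ch₂ | below q =
            let ml₁ , pf₁ = plusForest-cut pf q
                bq = cutsF-bound P q
                b₂ = cutsF-bound ts m₂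
            in Monomial-++ ml₁ ml₂ (≪-⊆ (there ∘ lea⊆ bq) (lea⊆ b₂) nP≪ts) ,
               child pf₁ (≪-⊆ (roo⊆ bq) id P≪n) (≪-⊆ (∷-⊆ (roo⊆ bq)) (roo⊆ b₂) nP≪ts) ch₂

    plusForest-cut : PlusForest F → (l , r) ∈ cutsF F → Monomial i l × PlusForest r
    plusForest-cut [] p with cutsF-[]⁻ p
    ... | refl , refl = [] , []
    plusForest-cut (tree {t = t} {ts = ts} pt t≪ts pf) p with cutsF-∷⁻ t ts p
    ... | cons-cut m₁ m₂ with plusTree-cut pt m₁ | plusForest-cut pf m₂
    ...   | ml₁ , none    | ml₂ , pf₂ = Monomial-++ ml₁ ml₂ (≪-⊆ (lea⊆ b₁) (lea⊆ b₂) t≪ts) , pf₂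
      where b₁ = cutsT-bound t m₁ ; b₂ = cutsF-bound ts m₂
    ...   | ml₁ , just p₁ | ml₂ , pf₂ =
            Monomial-++ ml₁ ml₂ (≪-⊆ (lea⊆ b₁) (lea⊆ b₂) t≪ts) ,
            tree p₁ (≪-⊆ (roo⊆ b₁ ∘ labels-[]⁺ _) (roo⊆ b₂) t≪ts) pf₂
      where b₁ = cutsT-bound t m₁ ; b₂ = cutsF-bound ts m₂

  mutual
    gTree-cut : ∀ {b} → GTree b t → b ≤ i → (l , r) ∈ cutsT t → Monomial i l × AtMostOne (GTree b) r
    gTree-cut (plus-root p) _ q with plusTree-cut p q
    ... | ml , none    = ml , none
    ... | ml , just p′ = ml , just (plus-root p′)
    gTree-cut {b = b} g@(minus-root {F₀ = F₀} {N} refl g₀ N<b F₀≪a aF₀≪N ch) b≤i q with cutsT⁻ q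
    ... | whole    = GForest⇒Monomial (GTree⇒GForest (GTree-mono b≤i g)) , none
    ... | below q′ with cutsF-++⁻ F₀ N q′
    ...   | app-cut m₁ m₂ with gForest-cut g₀ (≤-trans (m∸n≤m b (suc (sizeF N))) b≤i) m₁ | plusChildren-cut ch m₂
    ...     | ml₁ , empty       | ml₂ , ch₂ =
              Monomial-++ ml₁ ml₂ (≪-⊆ (there ∘ lea⊆ b₁) (lea⊆ b₂) aF₀≪N) ,
              just (plus-root (root ch₂ (≪-⊆ (∷-⊆ λ ()) (roo⊆ b₂) aF₀≪N)))
      where b₁ = cutsF-bound F₀ m₁ ; b₂ = cutsF-bound N m₂
    ...     | ml₁ , nonempty g₁ | ml₂ , ch₂ =
              Monomial-++ ml₁ ml₂ (≪-⊆ (there ∘ lea⊆ b₁) (lea⊆ b₂) aF₀≪N) ,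
              just (minus-root refl (GForest-mono (∸-monoʳ-≤ b (s≤s (roo-size b₂))) g₁) (≤-<-trans (roo-size b₂) N<b)
                               (≪-⊆ (roo⊆ b₁) id F₀≪a) (≪-⊆ (∷-⊆ (roo⊆ b₁)) (roo⊆ b₂) aF₀≪N) ch₂)
      where b₁ = cutsF-bound F₀ m₁ ; b₂ = cutsF-bound N m₂

    gForest-cut : ∀ {b} → GForest b F → b ≤ i → (l , r) ∈ cutsF F → Monomial i l × EmptyOr (GForest b) r
    gForest-cut {b = b} (gforest {ts = ts} {t = t} g t≪ts pf) b≤i p with cutsF-∷⁻ t ts p
    ... | cons-cut m₁ m₂ with gTree-cut g (≤-trans (m∸n≤m b (sizeF ts)) b≤i) m₁ | plusForest-cut pf m₂
    ...   | ml₁ , none    | ml₂ , pf₂ =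
            Monomial-++ ml₁ ml₂ (≪-⊆ (lea⊆ b₁) (lea⊆ b₂) t≪ts) , PlusForest⇒GForest pf₂
      where b₁ = cutsT-bound t m₁ ; b₂ = cutsF-bound ts m₂
    ...   | ml₁ , just g₁ | ml₂ , pf₂ =
            Monomial-++ ml₁ ml₂ (≪-⊆ (lea⊆ b₁) (lea⊆ b₂) t≪ts) ,
            nonempty (gforest (GTree-mono (∸-monoʳ-≤ b (roo-size b₂)) g₁)
                              (≪-⊆ (roo⊆ b₁ ∘ labels-[]⁺ _) (roo⊆ b₂) t≪ts) pf₂)
      where b₁ = cutsT-bound t m₁ ; b₂ = cutsF-bound ts m₂

  monomial-cut : Monomial i F → (l , r) ∈ cutsF F → Monomial i l × Monomial i r
  monomial-cut [] p with cutsF-[]⁻ p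
  ... | refl , refl = [] , []
  monomial-cut (factor {F = X} {G = Y} gX X≪Y mY) p with cutsF-++⁻ X Y p
  ... | app-cut m₁ m₂ with gForest-cut gX ≤-refl m₁ | monomial-cut mY m₂
  ...   | ml₁ , empty       | ml₂ , mr₂ = Monomial-++ ml₁ ml₂ (≪-⊆ (lea⊆ b₁) (lea⊆ b₂) X≪Y) , mr₂
    where b₁ = cutsF-bound X m₁ ; b₂ = cutsF-bound Y m₂
  ...   | ml₁ , nonempty g₁ | ml₂ , mr₂ =
          Monomial-++ ml₁ ml₂ (≪-⊆ (lea⊆ b₁) (lea⊆ b₂) X≪Y) , factor g₁ (≪-⊆ (roo⊆ b₁) (roo⊆ b₂) X≪Y) mr₂
    where b₁ = cutsF-bound X m₁ ; b₂ = cutsF-bound Y m₂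

-- From the recursive construction to the shape

PlusExceptLast : ℕ → List Sign → Set
PlusExceptLast b ws = All (_≡ plus) (take (length ws ∸ b) ws)

plusExceptLast-zero : ∀ ws → PlusExceptLast 0 ws ≡ All (_≡ plus) ws
plusExceptLast-zero ws = cong (All (_≡ plus)) (take-all (length ws) ws ≤-refl)

plusExceptLast-suc-∷ʳ : ∀ b ws w → PlusExceptLast (suc b) (ws ∷ʳ w) ≡ PlusExceptLast b ws
plusExceptLast-suc-∷ʳ b ws w = cong (All (_≡ plus)) (begin
  take (length (ws ∷ʳ w) ∸ suc b) (ws ∷ʳ w) ≡⟨ cong (λ k → take (k ∸ suc b) (ws ∷ʳ w)) (length-∷ʳ ws w) ⟩
  take (length ws ∸ b) (ws ∷ʳ w)            ≡⟨ take-∷ʳ (length ws ∸ b) ws w (m∸n≤m (length ws) b) ⟩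
  take (length ws ∸ b) ws                   ∎)
  where open ≡-Reasoning

plusExceptLast-∷ʳ⁻ : ∀ b ws w → PlusExceptLast b (ws ∷ʳ w) → PlusExceptLast (b ∸ 1) ws × (b ≡ 0 → w ≡ plus)
plusExceptLast-∷ʳ⁻ zero ws w h with All.++⁻ ws (subst id (plusExceptLast-zero (ws ∷ʳ w)) h)
... | ws+ , w+ ∷ [] = subst id (sym (plusExceptLast-zero ws)) ws+ , λ _ → w+
plusExceptLast-∷ʳ⁻ (suc b) ws w h = subst id (plusExceptLast-suc-∷ʳ b ws w) h , λ ()

plusExceptLast-∷ʳ⁺ : ∀ b ws w → (b ≡ 0 → w ≡ plus) → PlusExceptLast (b ∸ 1) ws → PlusExceptLast b (ws ∷ʳ w)
plusExceptLast-∷ʳ⁺ zero ws w w+ h =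
  subst id (sym (plusExceptLast-zero (ws ∷ʳ w))) (All.++⁺ (subst id (plusExceptLast-zero ws) h) (w+ refl ∷ []))
plusExceptLast-∷ʳ⁺ (suc b) ws w _ h = subst id (sym (plusExceptLast-suc-∷ʳ b ws w)) h

plusExceptLast-[plus] : ∀ b → PlusExceptLast b [ plus ]
plusExceptLast-[plus] zero          = refl ∷ []
plusExceptLast-[plus] (suc zero)    = []
plusExceptLast-[plus] (suc (suc b)) = []

m<o∸n⇒m+n<o : ∀ m n o → m < o ∸ n → m + n < o
m<o∸n⇒m+n<o m zero    o       h = subst (_< o) (sym (+-identityʳ m)) h
m<o∸n⇒m+n<o m (suc n) (suc o) h = subst (_< suc o) (sym (+-suc m n)) (s≤s (m<o∸n⇒m+n<o m n o h))

budget-attach : ∀ b N post → ((b ∸ 1) ∸ sizeF post) ∸ suc (sizeF N) ≡ b ∸ suc (sizeF (N ++ [ node n post ]))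
budget-attach {n} b N post = begin
  ((b ∸ 1) ∸ p) ∸ suc s           ≡⟨ cong (_∸ suc s) (∸-+-assoc b 1 p) ⟩
  (b ∸ suc p) ∸ suc s             ≡⟨ ∸-+-assoc b (suc p) (suc s) ⟩
  b ∸ (suc p + suc s)             ≡⟨ cong (b ∸_) (+-comm (suc p) (suc s)) ⟩
  b ∸ suc (s + suc p)             ≡⟨ cong (λ k → b ∸ suc k) (sym (sizeF-∷ʳ N (node n post))) ⟩
  b ∸ suc (sizeF (N ++ [ node n post ])) ∎
  where
  open ≡-Reasoning
  p = sizeF post
  s = sizeF N

size-attach-<⁺ : ∀ b N post → sizeF N < (b ∸ 1) ∸ sizeF post → sizeF (N ++ [ node n post ]) < b
size-attach-<⁺ {n} b N post N< =
  subst (_< b) (sym (sizeF-∷ʳ N (node n post)))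
        (m<o∸n⇒m+n<o (sizeF N) (suc (sizeF post)) b (subst (sizeF N <_) (∸-+-assoc b 1 (sizeF post)) N<))

size-attach-<⁻ : ∀ b N post → sizeF (N ++ [ node n post ]) < b → sizeF N < (b ∸ 1) ∸ sizeF post
size-attach-<⁻ {n} b N post N′<b =
  subst (sizeF N <_) (sym (∸-+-assoc b 1 (sizeF post)))
        (m+n≤o⇒m≤o∸n (suc (sizeF N)) (subst (_< b) (sizeF-∷ʳ N (node n post)) N′<b))

budget-plusStep : ∀ b → PlusStep n F G → (b ∸ 1) ∸ sizeF F ≡ b ∸ sizeF G
budget-plusStep {F = F} b step = trans (∸-+-assoc b 1 (sizeF F)) (cong (b ∸_) (sym (plusStep-size step)))

PlusForest-++ : PlusForest F → PlusForest G → labelsF F ≪ labelsF G → PlusForest (F ++ G)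
PlusForest-++ []                                   pG _   = pG
PlusForest-++ {G = G} (tree {t = t} {ts = ts} p t≪ts pf) pG F≪G =
  tree p (≪-labels-++ʳ ts G t≪ts (≪-⊆ ∈-++⁺ˡ id F≪G)) (PlusForest-++ pf pG (≪-⊆ (∈-++⁺ʳ (labelsT t)) id F≪G))

PlusChildren-∷ʳ : ∀ {P} → PlusChildren cs → PlusForest P → labelsF P ≪ [ n ] → labelsF cs ≪ n ∷ labelsF P →
                  PlusChildren (cs ++ [ node n P ])
PlusChildren-∷ʳ [] pf P≪n _ = child pf P≪n ≪-[]ʳ []
PlusChildren-∷ʳ {n = n} {P = P} (child {n = m} {ts = ts} {P = Q} qf Q≪m mQ≪ts ch) pf P≪n cs≪nP =
  child qf Q≪m (≪-labels-++ʳ ts [ node n P ] mQ≪ts (≪-⊆ ∈-++⁺ˡ (labels-[]⁻ (node n P)) cs≪nP))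
        (PlusChildren-∷ʳ ch pf P≪n (≪-⊆ (∈-++⁺ʳ (m ∷ labelsF Q)) id cs≪nP))

PlusTree-attach : ∀ {P} → PlusTree (node a cs) → PlusForest P → a ∷ labelsF cs ≪ labelsF P →
                  (a ∷ labelsF cs) ++ labelsF P ≪ [ n ] → PlusTree (node a (cs ++ [ node n P ]))
PlusTree-attach {a = a} {cs = cs} {n = n} {P = P} (root ch a≪cs) pf acs≪P acsP≪n =
  root (PlusChildren-∷ʳ ch pf (≪-⊆ (∈-++⁺ʳ (a ∷ labelsF cs)) id acsP≪n)
                           (≪-∷ʳ (≪-⊆ (∈-++⁺ˡ ∘ there) id acsP≪n) (≪-⊆ there id acs≪P)))
       (≪-labels-++ʳ cs [ node n P ] a≪cs
          (≪-⊆ id (labels-[]⁻ (node n P))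
               (≪-∷ʳ (≪-⊆ (∈-++⁺ˡ {ys = labelsF P} ∘ ∷-⊆ λ ()) id acsP≪n) (≪-⊆ (∷-⊆ λ ()) id acs≪P))))

PlusForest-attach : ∀ {post} pre → PlusForest (pre ++ node a cs ∷ post) → labelsF (pre ++ node a cs ∷ post) ≪ [ n ] →
                    PlusForest (pre ++ [ node a (cs ++ [ node n post ]) ])
PlusForest-attach [] (tree p acs≪post pf) ≪n = tree (PlusTree-attach p pf acs≪post ≪n) ≪-[]ʳ []
PlusForest-attach {a = a} {cs = cs} {post = post} (u ∷ pre) (tree p u≪ pf) ≪n =
  tree p (≪-plusStep (attach pre a cs post) u≪ (≪-⊆ ∈-++⁺ˡ id ≪n))
         (PlusForest-attach pre pf (≪-⊆ (∈-++⁺ʳ (labelsT u)) id ≪n))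

GTree-attach : ∀ {b post} → GTree ((b ∸ 1) ∸ sizeF post) (node a cs) → PlusForest post → a ∷ labelsF cs ≪ labelsF post →
               (a ∷ labelsF cs) ++ labelsF post ≪ [ n ] → GTree b (node a (cs ++ [ node n post ]))
GTree-attach (plus-root p) pf ≪post ≪n = plus-root (PlusTree-attach p pf ≪post ≪n)
GTree-attach {a = a} {n = n} {b = b} {post = post} (minus-root {F₀ = F₀} {N} refl g₀ N<b F₀≪a aF₀≪N ch) pf ≪post ≪n =
  minus-root (++-assoc F₀ N [ node n post ]) (subst (λ c → GForest c F₀) (budget-attach b N post) g₀)
             (size-attach-<⁺ b N post N<b) F₀≪a aF₀≪N′ ch′
  where
  N′ = N ++ [ node n post ]
  aF₀⊆ : a ∷ labelsF F₀ ⊆ a ∷ labelsF (F₀ ++ N)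
  aF₀⊆ = ∷-⊆ (labels-++ˡ F₀ N)
  aF₀≪N′ : a ∷ labelsF F₀ ≪ labelsF N′
  aF₀≪N′ = ≪-labels-++ʳ N [ node n post ] aF₀≪N
             (≪-⊆ id (labels-[]⁻ (node n post)) (≪-∷ʳ (≪-⊆ (∈-++⁺ˡ ∘ aF₀⊆) id ≪n) (≪-⊆ aF₀⊆ id ≪post)))
  ch′ : PlusChildren N′
  ch′ = PlusChildren-∷ʳ ch pf (≪-⊆ (∈-++⁺ʳ (a ∷ labelsF (F₀ ++ N))) id ≪n)
          (≪-∷ʳ (≪-⊆ (∈-++⁺ˡ ∘ there ∘ labels-++ʳ F₀ N) id ≪n) (≪-⊆ (there ∘ labels-++ʳ F₀ N) id ≪post))

GForest-atRight : ∀ b → GForest (b ∸ 1) F → labelsF F ≪ [ n ] → GForest b (F ++ [ leaf n ])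
GForest-atRight {n = n} b (gforest {ts = ts} {t = t} g t≪ts pf) F≪n =
  gforest (subst (λ c → GTree c t) (budget-plusStep b (atRight ts)) g)
          (≪-plusStep (atRight ts) t≪ts (≪-⊆ ∈-++⁺ˡ id F≪n))
          (PlusForest-++ pf (tree (root [] ≪-[]ʳ) ≪-[]ʳ []) (≪-⊆ (∈-++⁺ʳ (labelsT t)) id F≪n))

GForest-attach : ∀ b {post} pre → GForest (b ∸ 1) (pre ++ node a cs ∷ post) → labelsF (pre ++ node a cs ∷ post) ≪ [ n ] →
                 GForest b (pre ++ [ node a (cs ++ [ node n post ]) ])
GForest-attach b [] (gforest g acs≪post pf) F≪n = GTree⇒GForest (GTree-attach g pf acs≪post F≪n)
GForest-attach {a = a} {cs = cs} b {post} (u ∷ pre) (gforest g u≪ pf) F≪n =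
  gforest (subst (λ c → GTree c u) (budget-plusStep b (attach pre a cs post)) g)
          (≪-plusStep (attach pre a cs post) u≪ (≪-⊆ ∈-++⁺ˡ id F≪n))
          (PlusForest-attach pre pf (≪-⊆ (∈-++⁺ʳ (labelsT u)) id F≪n))

GForest-plusStep : ∀ b → PlusStep n F G → GForest (b ∸ 1) F → labelsF F ≪ [ n ] → GForest b G
GForest-plusStep b (atRight F)            = GForest-atRight b
GForest-plusStep b (attach pre a cs post) = GForest-attach b pre

LabelsInRange : Forest → Set
LabelsInRange F = ∀ {x} → x ∈ labelsF F → 1 ≤ x × x ≤ sizeF F

gen-length : ∀ {ws} → Gen ws F → length ws ≡ sizeF F
gen-length (base e)           = refl
gen-length (minus {ws} {F} g) = trans (length-∷ʳ ws minus) (trans (cong suc (gen-length g)) (sym (sizeF-[] (node (suc (length ws)) F))))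
gen-length (plus {ws} g step) = trans (length-∷ʳ ws plus) (trans (cong suc (gen-length g)) (sym (plusStep-size step)))

gen-labels : ∀ {ws} → Gen ws F → LabelsInRange F
gen-labels (base e) (here refl) = s≤s z≤n , s≤s z≤n
gen-labels (minus {ws} {F} g) p rewrite sizeF-[] (node (suc (length ws)) F) with labels-[]⁻ (node (suc (length ws)) F) p
... | here refl = s≤s z≤n , s≤s (≤-reflexive (gen-length g))
... | there q   = proj₁ (gen-labels g q) , m≤n⇒m≤1+n (proj₂ (gen-labels g q))
gen-labels (plus g step) p rewrite plusStep-size step with plusStep-∈⁻ step p
... | inj₁ q    = proj₁ (gen-labels g q) , m≤n⇒m≤1+n (proj₂ (gen-labels g q))
... | inj₂ refl = s≤s z≤n , s≤s (≤-reflexive (gen-length g))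

gen-≪ : ∀ {ws} → Gen ws F → labelsF F ≪ [ suc (length ws) ]
gen-≪ g p (here refl) = s≤s (subst (_ ≤_) (sym (gen-length g)) (proj₂ (gen-labels g p)))

gen⇒GForest : ∀ {ws b} → Gen ws F → PlusExceptLast b ws → GForest b F
gen⇒GForest (base e) _ = GTree⇒GForest (plus-root (root [] ≪-[]ʳ))
gen⇒GForest {b = b} (minus {ws} {F} g) ok with plusExceptLast-∷ʳ⁻ b ws minus ok
... | ok′ , last+ = GTree⇒GForest (minus-root (sym (++-identityʳ F)) (gen⇒GForest g ok′) (0<b b last+) (gen-≪ g) ≪-[]ʳ [])
  where
  0<b : ∀ b → (b ≡ 0 → minus ≡ plus) → 0 < b
  0<b zero    last+ with last+ refl
  ... | ()
  0<b (suc b) _ = s≤s z≤n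
gen⇒GForest {b = b} (plus {ws} g step) ok =
  GForest-plusStep b step (gen⇒GForest g (proj₁ (plusExceptLast-∷ʳ⁻ b ws plus ok))) (gen-≪ g)

module Relabel {f : ℕ → ℕ} (f-mono : f Preserves _<_ ⟶ _<_) where

  ≪-relabel : xs′ ≡ map f xs → ys′ ≡ map f ys → xs ≪ ys → xs′ ≪ ys′
  ≪-relabel {xs = xs} {ys = ys} refl refl xs≪ys p q with ∈-map⁻ f {xs = xs} p | ∈-map⁻ f {xs = ys} q
  ... | _ , p′ , refl | _ , q′ , refl = f-mono (xs≪ys p′ q′)

  mutual
    relabel-PlusTree : PlusTree t → PlusTree (relabelT f t)
    relabel-PlusTree (root {cs = cs} ch a≪cs) = root (relabel-PlusChildren ch) (≪-relabel refl (labels-relabelF f cs) a≪cs)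

    relabel-PlusChildren : PlusChildren F → PlusChildren (relabelF f F)
    relabel-PlusChildren [] = []
    relabel-PlusChildren (child {n = n} {ts = ts} {P = P} pf P≪n nP≪ts ch) =
      child (relabel-PlusForest pf) (≪-relabel (labels-relabelF f P) refl P≪n)
            (≪-relabel (cong (f n ∷_) (labels-relabelF f P)) (labels-relabelF f ts) nP≪ts) (relabel-PlusChildren ch)

    relabel-PlusForest : PlusForest F → PlusForest (relabelF f F)
    relabel-PlusForest [] = []
    relabel-PlusForest (tree {t = t} {ts = ts} p t≪ts pf) =
      tree (relabel-PlusTree p) (≪-relabel (labels-relabelT f t) (labels-relabelF f ts) t≪ts) (relabel-PlusForest pf)

  mutual
    relabel-GTree : ∀ {b} → GTree b t → GTree b (relabelT f t)
    relabel-GTree (plus-root p) = plus-root (relabel-PlusTree p)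
    relabel-GTree {b = b} (minus-root {a = a} {F₀ = F₀} {N} refl g₀ N<b F₀≪a aF₀≪N ch) =
      minus-root (relabelF-++ f F₀ N)
                 (subst (λ s → GForest (b ∸ suc s) (relabelF f F₀)) (sym (size-relabelF f N)) (relabel-GForest g₀))
                 (subst (_< b) (sym (size-relabelF f N)) N<b)
                 (≪-relabel (labels-relabelF f F₀) refl F₀≪a)
                 (≪-relabel (cong (f a ∷_) (labels-relabelF f F₀)) (labels-relabelF f N) aF₀≪N)
                 (relabel-PlusChildren ch)

    relabel-GForest : ∀ {b} → GForest b F → GForest b (relabelF f F)
    relabel-GForest {b = b} (gforest {ts = ts} {t = t} g t≪ts pf) =
      gforest (subst (λ s → GTree (b ∸ s) (relabelT f t)) (sym (size-relabelF f ts)) (relabel-GTree g))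
              (≪-relabel (labels-relabelT f t) (labels-relabelF f ts) t≪ts) (relabel-PlusForest pf)

  relabel-Monomial : ∀ {i} → Monomial i F → Monomial i (relabelF f F)
  relabel-Monomial [] = []
  relabel-Monomial {i = i} (factor {F = X} {G = Y} gX X≪Y mY) =
    subst (Monomial i) (sym (relabelF-++ f X Y))
          (factor (relabel-GForest gX) (≪-relabel (labels-relabelF f X) (labels-relabelF f Y) X≪Y) (relabel-Monomial mY))

InB-labels : ∀ {i} → InB i F → LabelsInRange F
InB-labels one = λ ()
InB-labels (mul {G} {F} (_ , gen , _) F∈B) p
  rewrite sizeF-++ G (relabelF (sizeF G +_) F) | size-relabelF (sizeF G +_) F
  with ∈-labels-++⁻ G _ p
... | inj₁ q = proj₁ (gen-labels gen q) , ≤-trans (proj₂ (gen-labels gen q)) (m≤m+n (sizeF G) (sizeF F))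
... | inj₂ q rewrite labels-relabelF (sizeF G +_) F with ∈-map⁻ (sizeF G +_) q
... | y , q′ , refl =
  ≤-trans (proj₁ (InB-labels F∈B q′)) (m≤n+m y (sizeF G)) , +-monoʳ-≤ (sizeF G) (proj₂ (InB-labels F∈B q′))

InB⇒Monomial : ∀ {i} → InB i F → Monomial i F
InB⇒Monomial one = []
InB⇒Monomial (mul {G} {F} (_ , gen , ok) F∈B) =
  factor (gen⇒GForest gen ok) G≪F′ (Relabel.relabel-Monomial (+-monoʳ-< (sizeF G)) (InB⇒Monomial F∈B))
  where
  G≪F′ : labelsF G ≪ labelsF (relabelF (sizeF G +_) F)
  G≪F′ p q rewrite labels-relabelF (sizeF G +_) F with ∈-map⁻ (sizeF G +_) q
  ... | _ , q′ , refl = ≤-<-trans (proj₂ (gen-labels gen p)) (m<m+n (sizeF G) (proj₁ (InB-labels F∈B q′)))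

-- Standardisation

countLess-filter : ∀ x xs → countLess x xs ≡ length (filter (_<? x) xs)
countLess-filter x []       = refl
countLess-filter x (y ∷ ys) with does (y <? x)
... | true  = cong suc (countLess-filter x ys)
... | false = countLess-filter x ys

countLess-++ : ∀ x xs ys → countLess x (xs ++ ys) ≡ countLess x xs + countLess x ys
countLess-++ x xs ys = begin
  countLess x (xs ++ ys)                                         ≡⟨ countLess-filter x (xs ++ ys) ⟩
  length (filter (_<? x) (xs ++ ys))                             ≡⟨ cong length (filter-++ (_<? x) xs ys) ⟩
  length (filter (_<? x) xs ++ filter (_<? x) ys)                ≡⟨ length-++ (filter (_<? x) xs) ⟩
  length (filter (_<? x) xs) + length (filter (_<? x) ys)        ≡⟨ sym (cong₂ _+_ (countLess-filter x xs) (countLess-filter x ys)) ⟩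
  countLess x xs + countLess x ys                                ∎
  where open ≡-Reasoning

countLess-↭ : ∀ x → xs ↭ ys → countLess x xs ≡ countLess x ys
countLess-↭ {xs} {ys} x xs↭ys =
  trans (countLess-filter x xs) (trans (↭-length (filter-↭ (_<? x) xs↭ys)) (sym (countLess-filter x ys)))

countLess-all : ∀ x xs → (∀ {y} → y ∈ xs → y < x) → countLess x xs ≡ length xs
countLess-all x xs all< = trans (countLess-filter x xs) (cong length (filter-all (_<? x) (All.tabulate all<)))

countLess-none : ∀ x xs → (∀ {y} → y ∈ xs → x ≤ y) → countLess x xs ≡ 0
countLess-none x xs none< = trans (countLess-filter x xs) (cong length (filter-none (_<? x) (All.tabulate (≤⇒≯ ∘ none<))))

rank : Forest → ℕ → ℕ
rank F x = suc (countLess x (labelsF F))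

std-++ : ∀ F G → labelsF F ≪ labelsF G → std (F ++ G) ≡ std F · std G
std-++ F G F≪G = trans (relabelF-++ (rank (F ++ G)) F G) (cong₂ _++_ on-F (trans on-G (sym (relabelF-∘ _ (rank G) G))))
  where
  open ≡-Reasoning
  countLess-F++G : ∀ x → countLess x (labelsF (F ++ G)) ≡ countLess x (labelsF F) + countLess x (labelsF G)
  countLess-F++G x = trans (cong (countLess x) (labelsF-++ F G)) (countLess-++ x (labelsF F) (labelsF G))

  on-F : relabelF (rank (F ++ G)) F ≡ std F
  on-F = relabelF-cong F λ {x} p → cong suc (begin
    countLess x (labelsF (F ++ G))                    ≡⟨ countLess-F++G x ⟩
    countLess x (labelsF F) + countLess x (labelsF G) ≡⟨ cong (countLess x (labelsF F) +_) (countLess-none x _ (<⇒≤ ∘ F≪G p)) ⟩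
    countLess x (labelsF F) + 0                       ≡⟨ +-identityʳ _ ⟩
    countLess x (labelsF F)                           ∎)

  on-G : relabelF (rank (F ++ G)) G ≡ relabelF ((sizeF (std F) +_) ∘ rank G) G
  on-G = relabelF-cong G λ {y} q → begin
    suc (countLess y (labelsF (F ++ G)))                    ≡⟨ cong suc (countLess-F++G y) ⟩
    suc (countLess y (labelsF F) + countLess y (labelsF G)) ≡⟨ cong (λ k → suc (k + _)) (countLess-all y _ (λ p → F≪G p q)) ⟩
    suc (length (labelsF F) + countLess y (labelsF G))      ≡⟨ cong (λ k → suc (k + _)) (trans (length-labelsF F) (sym (size-relabelF _ F))) ⟩
    suc (sizeF (std F) + countLess y (labelsF G))           ≡⟨ sym (+-suc (sizeF (std F)) _) ⟩
    sizeF (std F) + rank G y                                ∎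

countLess-add : ∀ x → ys ↭ xs ++ [ n ] → countLess x ys ≡ countLess x xs + countLess x [ n ]
countLess-add {xs = xs} {n = n} x ys↭ = trans (countLess-↭ x ys↭) (countLess-++ x xs [ n ])

rank-add-max-below : ∀ F G → labelsF G ↭ labelsF F ++ [ n ] → labelsF F ≪ [ n ] →
                     x ∈ labelsF F → rank G x ≡ rank F x
rank-add-max-below {n} {x} F G G↭ F≪n p = cong suc (begin
  countLess x (labelsF G)                     ≡⟨ countLess-add x G↭ ⟩
  countLess x (labelsF F) + countLess x [ n ] ≡⟨ cong (countLess x (labelsF F) +_) (countLess-none x [ n ] x≤n) ⟩
  countLess x (labelsF F) + 0                 ≡⟨ +-identityʳ _ ⟩
  countLess x (labelsF F)                     ∎)
  where
  open ≡-Reasoning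
  x≤n : ∀ {y} → y ∈ [ n ] → x ≤ y
  x≤n (here refl) = <⇒≤ (F≪n p (here refl))

rank-add-max : ∀ F G → labelsF G ↭ labelsF F ++ [ n ] → labelsF F ≪ [ n ] → rank G n ≡ suc (sizeF F)
rank-add-max {n} F G G↭ F≪n = cong suc (begin
  countLess n (labelsF G)                     ≡⟨ countLess-add n G↭ ⟩
  countLess n (labelsF F) + countLess n [ n ] ≡⟨ cong₂ _+_ (countLess-all n _ (λ p → F≪n p (here refl)))
                                                            (countLess-none n [ n ] λ { (here refl) → ≤-refl }) ⟩
  length (labelsF F) + 0                      ≡⟨ +-identityʳ _ ⟩
  length (labelsF F)                          ≡⟨ length-labelsF F ⟩
  sizeF F                                     ∎)
  where open ≡-Reasoning

std-plusStep : PlusStep n F G → labelsF F ≪ [ n ] → PlusStep (suc (sizeF F)) (std F) (std G)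
std-plusStep {F = F} {G = G} step F≪n =
  subst₂ (λ m F′ → PlusStep m F′ (std G))
         (rank-add-max F G G↭ F≪n) (relabelF-cong F (rank-add-max-below F G G↭ F≪n)) (relabel-plusStep (rank G) step)
  where G↭ = plusStep-labels step

std-root : ∀ a F → labelsF F ≪ [ a ] → std [ node a F ] ≡ [ node (suc (sizeF F)) (std F) ]
std-root a F F≪a =
  cong₂ (λ a′ F′ → [ node a′ F′ ]) (rank-add-max F [ node a F ] aF↭ F≪a)
        (relabelF-cong F (rank-add-max-below F [ node a F ] aF↭ F≪a))
  where aF↭ = ↭-trans (↭-reflexive (labelsF-[] (node a F))) (∷↭∷ʳ a (labelsF F))


-- From the shape back to the recursive construction

PlusChildren-∷ʳ⁻ : ∀ {P} cs → PlusChildren (cs ++ [ node n P ]) →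
                   PlusChildren cs × PlusForest P × labelsF P ≪ [ n ] × labelsF cs ≪ n ∷ labelsF P
PlusChildren-∷ʳ⁻ [] (child pf P≪n _ []) = [] , pf , P≪n , ≪-[]ˡ
PlusChildren-∷ʳ⁻ {n = n} {P = P} (node m Q ∷ cs) (child qf Q≪m mQ≪ ch) with PlusChildren-∷ʳ⁻ cs ch
... | ch₀ , pf , P≪n , cs≪nP =
  child qf Q≪m (≪-⊆ id (labels-++ˡ cs _) mQ≪) ch₀ , pf , P≪n ,
  ≪-++ˡ (≪-⊆ id (labels-++ʳ cs _ ∘ labels-[]⁺ (node n P)) mQ≪) cs≪nP

PlusForest-∷ʳ⁻ : ∀ {u} ts → PlusForest (ts ++ [ u ]) → PlusForest ts × PlusTree u × labelsF ts ≪ labelsT u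
PlusForest-∷ʳ⁻ []       (tree p _ _) = [] , p , ≪-[]ˡ
PlusForest-∷ʳ⁻ {u = u} (v ∷ ts) (tree p v≪ pf) with PlusForest-∷ʳ⁻ ts pf
... | pf₀ , pu , ts≪u =
  tree p (≪-⊆ id (labels-++ˡ ts _) v≪) pf₀ , pu , ≪-++ˡ (≪-⊆ id (labels-++ʳ ts _ ∘ labels-[]⁺ u) v≪) ts≪u

PlusTree-detach : ∀ {P} → PlusTree (node a (cs ++ [ node n P ])) → PlusForest (node a cs ∷ P) × labelsF (node a cs ∷ P) ≪ [ n ]
PlusTree-detach {a = a} {cs = cs} {n = n} {P = P} (root ch a≪) with PlusChildren-∷ʳ⁻ cs ch
... | ch₀ , pf , P≪n , cs≪nP =
  tree (root ch₀ (≪-⊆ id (labels-++ˡ cs _) a≪)) acs≪P pf ,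
  ≪-++ˡ (≪-∷ˡ (≪-⊆ id n∈ a≪) (≪-⊆ id (∷-⊆ λ ()) cs≪nP)) P≪n
  where
  n∈ : [ n ] ⊆ labelsF (cs ++ [ node n P ])
  n∈ (here refl) = labels-++ʳ cs _ (here refl)
  acs≪P : a ∷ labelsF cs ≪ labelsF P
  acs≪P = ≪-∷ˡ (≪-⊆ id (labels-++ʳ cs _ ∘ labels-[]⁺ (node n P) ∘ there) a≪) (≪-⊆ id there cs≪nP)

data LastStep (b : ℕ) : Forest → Set where
  leaf-step  : ∀ m → LastStep b [ leaf m ]
  minus-step : ∀ {m} → GForest (b ∸ 1) F → 0 < b → labelsF F ≪ [ m ] → LastStep b [ node m F ]
  plus-step  : ∀ {m} → PlusStep m F G → GForest (b ∸ 1) F → labelsF F ≪ [ m ] → LastStep b G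

lastStep-GTree : ∀ {b} → GTree b t → LastStep b [ t ]
lastStep-GTree (plus-root {t = node a cs} p) with reverseView cs
... | [] = leaf-step a
... | cs₀ ∶ _ ∶ʳ node n P with PlusTree-detach p
...   | tree p₀ acs≪P pf , ≪n = plus-step (attach [] a cs₀ P) (gforest (plus-root p₀) acs≪P pf) ≪n
lastStep-GTree {b = b} (minus-root {a = a} {F₀ = F₀} {N} refl g₀ N<b F₀≪a aF₀≪N ch) with reverseView N
... | [] = subst (λ cs → LastStep b [ node a cs ]) (sym (++-identityʳ F₀)) (minus-step g₀ N<b F₀≪a)
... | N₀ ∶ _ ∶ʳ node n P with PlusChildren-∷ʳ⁻ N₀ ch
...   | ch₀ , pf , P≪n , N₀≪nP =
  subst (λ cs → LastStep b [ node a cs ]) (++-assoc F₀ N₀ [ node n P ])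
        (plus-step (attach [] a (F₀ ++ N₀) P) (gforest t₀ aF₀N₀≪P pf) (≪-++ˡ aF₀N₀≪n P≪n))
  where
  t₀ : GTree ((b ∸ 1) ∸ sizeF P) (node a (F₀ ++ N₀))
  t₀ = minus-root refl (subst (λ c → GForest c F₀) (sym (budget-attach b N₀ P)) g₀) (size-attach-<⁻ b N₀ P N<b)
                  F₀≪a (≪-⊆ id (labels-++ˡ N₀ _) aF₀≪N) ch₀
  P⊆N : labelsF P ⊆ labelsF (N₀ ++ [ node n P ])
  P⊆N = labels-++ʳ N₀ _ ∘ labels-[]⁺ (node n P) ∘ there
  n∈N : [ n ] ⊆ labelsF (N₀ ++ [ node n P ])
  n∈N (here refl) = labels-++ʳ N₀ _ (here refl)
  aF₀N₀≪P : a ∷ labelsF (F₀ ++ N₀) ≪ labelsF P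
  aF₀N₀≪P = ≪-∷ˡ (≪-⊆ (∷-⊆ λ ()) P⊆N aF₀≪N) (≪-labels-++ˡ F₀ N₀ (≪-⊆ there P⊆N aF₀≪N) (≪-⊆ id there N₀≪nP))
  aF₀N₀≪n : a ∷ labelsF (F₀ ++ N₀) ≪ [ n ]
  aF₀N₀≪n = ≪-∷ˡ (≪-⊆ (∷-⊆ λ ()) n∈N aF₀≪N) (≪-labels-++ˡ F₀ N₀ (≪-⊆ there n∈N aF₀≪N) (≪-⊆ id (∷-⊆ λ ()) N₀≪nP))

lastStep : ∀ {b} → GForest b F → LastStep b F
lastStep (gforest {ts = ts} g t≪ts pf) with reverseView ts
... | [] = lastStep-GTree g
lastStep {b = b} (gforest {t = t} g t≪ts pf) | ts₀ ∶ _ ∶ʳ node a cs with PlusForest-∷ʳ⁻ ts₀ pf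
... | pf₀ , pu , ts₀≪u with reverseView cs
...   | [] =
  plus-step (atRight (t ∷ ts₀))
            (gforest (subst (λ c → GTree c t) (sym (budget-plusStep b (atRight ts₀))) g)
                     (≪-⊆ id (labels-++ˡ ts₀ _) t≪ts) pf₀)
            (≪-++ˡ (≪-⊆ id (λ { (here refl) → labels-++ʳ ts₀ _ (here refl) }) t≪ts) ts₀≪u)
...   | cs₀ ∶ _ ∶ʳ node n P with PlusTree-detach pu
...     | pf′ , D≪n =
  plus-step (attach (t ∷ ts₀) a cs₀ P)
            (gforest (subst (λ c → GTree c t) (sym (budget-plusStep b step)) g) (≪-⊆ id (plusStep-⊆ step) t≪ts)
                     (PlusForest-++ pf₀ pf′ (≪-⊆ id D⊆u ts₀≪u)))
            (≪-++ˡ (≪-⊆ id n∈ts t≪ts) (≪-labels-++ˡ ts₀ D (≪-⊆ id n∈u ts₀≪u) D≪n))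
  where
  u = node a (cs₀ ++ [ node n P ])
  D = node a cs₀ ∷ P
  step = attach ts₀ a cs₀ P
  D⊆u : labelsF D ⊆ labelsT u
  D⊆u = labels-[]⁻ u ∘ plusStep-⊆ (attach [] a cs₀ P)
  n∈u : [ n ] ⊆ labelsT u
  n∈u (here refl) = there (labels-++ʳ cs₀ _ (here refl))
  n∈ts : [ n ] ⊆ labelsF (ts₀ ++ [ u ])
  n∈ts = labels-++ʳ ts₀ _ ∘ labels-[]⁺ u ∘ n∈u

std-length : ∀ {ws} → Gen ws (std F) → length ws ≡ sizeF F
std-length {F = F} gen = trans (gen-length gen) (size-relabelF _ F)

stdInG-root : ∀ {b} → 0 < b → labelsF F ≪ [ a ] → InG (b ∸ 1) (std F) → InG b (std [ node a F ])
stdInG-root {F = F} {a = a} {b = b} 0<b F≪a (ws , gen , ok) =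
  ws ∷ʳ minus ,
  subst (Gen (ws ∷ʳ minus)) (trans (cong (λ k → [ node (suc k) (std F) ]) (std-length gen)) (sym (std-root a F F≪a))) (minus gen) ,
  plusExceptLast-∷ʳ⁺ b ws minus (λ { refl → ⊥-elim (<-irrefl refl 0<b) }) ok

stdInG-plusStep : ∀ {b} → PlusStep n F G → labelsF F ≪ [ n ] → InG (b ∸ 1) (std F) → InG b (std G)
stdInG-plusStep {F = F} {G = G} {b = b} step F≪n (ws , gen , ok) =
  ws ∷ʳ plus ,
  plus gen (subst (λ k → PlusStep (suc k) (std F) (std G)) (sym (std-length gen)) (std-plusStep step F≪n)) ,
  plusExceptLast-∷ʳ⁺ b ws plus (λ _ → refl) ok

GForest⇒stdInG : ∀ {b} → GForest b F → InG b (std F)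
GForest⇒stdInG {F = F} = go (sizeF F) ≤-refl
  where
  go : ∀ k {b F} → sizeF F ≤ k → GForest b F → InG b (std F)
  go zero    {F = node _ _ ∷ _} () _
  go (suc k) {b} size≤ g with lastStep g
  ... | leaf-step m = [ plus ] , subst (Gen [ plus ]) (sym (std-root m [] ≪-[]ˡ)) (base plus) , plusExceptLast-[plus] b
  ... | minus-step {F = F₀} g₀ 0<b F₀≪m =
        stdInG-root {b = b} 0<b F₀≪m (go k (s≤s⁻¹ (subst (_≤ suc k) (+-identityʳ _) size≤)) g₀)
  ... | plus-step step g′ F′≪m =
        stdInG-plusStep {b = b} step F′≪m (go k (s≤s⁻¹ (subst (_≤ suc k) (plusStep-size step) size≤)) g′)

Monomial⇒stdInB : ∀ {i} → Monomial i F → InB i (std F)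
Monomial⇒stdInB []                                = one
Monomial⇒stdInB {i = i} (factor {F = X} {G = Y} gX X≪Y mY) =
  subst (InB i) (sym (std-++ X Y X≪Y)) (mul (GForest⇒stdInG gX) (Monomial⇒stdInB mY))

Δterms-closed : ∀ {i A B} → 1 ≤ i → InB i F → (A , B) ∈ Δterms F → InB i A × InB i B
Δterms-closed 1≤i F∈B m with ∈-map⁻ _ m
... | _ , lr∈cuts , refl with CutClosure.monomial-cut 1≤i (InB⇒Monomial F∈B) lr∈cuts
...   | ml , mr = Monomial⇒stdInB ml , Monomial⇒stdInB mr

coeffΔ-absent : ∀ {c ℓ} (K : Field c ℓ) F A B → (∀ {l r} → (l , r) ∈ Δterms F → ¬ (l ≡ A × r ≡ B)) →
                coeffΔ K F A B ≡ Field.0# K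
coeffΔ-absent K F A B absent = go (Δterms F) absent
  where
  open Field K using (0#; 1#) renaming (_+_ to _+K_)
  go : ∀ terms → (∀ {l r} → (l , r) ∈ terms → ¬ (l ≡ A × r ≡ B)) →
       foldr (λ { (l , r) acc → if does (l ≟F A) ∧ does (r ≟F B) then 1# +K acc else acc }) 0# terms ≡ 0#
  go []              _      = refl
  go ((l , r) ∷ terms) absent with l ≟F A | r ≟F B
  ... | yes refl | yes refl = ⊥-elim (absent (here refl) (refl , refl))
  ... | yes _    | no _     = go terms (absent ∘ there)
  ... | no _     | _        = go terms (absent ∘ there)

proposition1p10 : ∀ {c ℓ} (K : Field c ℓ) (i : ℕ) → i ≥ 1 →
    ∀ F → InB i F → ∀ A B → ¬ (InB i A × InB i B) →
    Field._≈_ K (coeffΔ K F A B) (Field.0# K)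
proposition1p10 K i 1≤i F F∈B A B A⊗B∉ =
  Field.reflexive K (coeffΔ-absent K F A B λ { m (refl , refl) → A⊗B∉ (Δterms-closed 1≤i F∈B m) })
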